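{- For all sets $s$ and $t$ (not necessarily distinct), $\mathrm{Pow}^*_{1,2}(\{s,t\})=s\otimes t$.
   Context: For sets $s,t$, $s\otimes t:=\{\{u,v\} : u\in s,\ v\in t\}$. For a set $S$, $\mathrm{Pow}^*_{1,2}(S):=\{t\subseteq\bigcup S : 1\le|t|\le 2 \text{ and } t\cap s\ne\emptyset \text{ for every } s\in S\}$. -}

module Defs where

open import Level using (Level; 0ℓ; suc)
open import Data.Product using (Σ; ∃; _×_; _,_)
open import Data.Sum using (_⊎_)
open import Relation.Binary.PropositionalEquality using (_≡_)
open import Relation.Unary using (Pred; _∈_; _⊆_; _∪_; _∩_; _≐_; Satisfiable)

Subset : Set → Set₁
Subset A = Pred A 0ℓ

-- Sets of sets (families) are predicates on subsets, up to extensional equality.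
Family : Set → (ℓ : Level) → Set _
Family A ℓ = Pred (Subset A) ℓ

pair : {A : Set} → A → A → Subset A
pair u v = λ x → x ≡ u ⊎ x ≡ v

pairF : {A : Set} → Subset A → Subset A → Family A 0ℓ
pairF s t = λ X → X ≐ s ⊎ X ≐ t

⋃ : {A : Set} → Family A 0ℓ → Pred A (suc 0ℓ)
⋃ S = λ x → ∃ λ s → s ∈ S × x ∈ s

-- 1 ≤ |X| ≤ 2 : X is nonempty with at most two elements, i.e. X = {a , b} for some a, b.
Card1to2 : {A : Set} → Subset A → Set
Card1to2 {A} X = Σ A λ a → Σ A λ b → X ≐ pair a b

_⊗_ : {A : Set} → Subset A → Subset A → Family A 0ℓ
(s ⊗ t) X = Σ _ λ u → Σ _ λ v → u ∈ s × v ∈ t × X ≐ pair u v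

Pow*₁₂ : {A : Set} → Family A 0ℓ → Family A (suc 0ℓ)
Pow*₁₂ S X = X ⊆ ⋃ S × Card1to2 X × (∀ {s} → s ∈ S → Satisfiable (X ∩ s))

_≐F_ : {A : Set} {ℓ₁ ℓ₂ : Level} → Family A ℓ₁ → Family A ℓ₂ → Set _
F ≐F G = ∀ X → (X ∈ F → X ∈ G) × (X ∈ G → X ∈ F)

{-# OPTIONS --safe #-}
module Submission where

-- A set X = {a , b} meeting s and t contains some x ∈ s and y ∈ t. If x and y are
-- different points among a, b then X = {x , y}; if they are the same point, it lies
-- in s ∩ t and the remaining element c ∈ s ∪ t, so X = {c , x} or X = {x , c}.
-- Case analysis on which of a, b the witnesses are avoids deciding x ≟ y.

open import Defs
open import Data.Product using (∃; _×_; _,_; proj₁; proj₂)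
open import Data.Sum using (_⊎_; inj₁; inj₂; swap)
open import Relation.Binary.PropositionalEquality using (_≡_; refl)
open import Relation.Unary using (_∈_; _⊆_; _≐_)
open import Relation.Unary.Properties using (≐-refl; ≐-trans)

private
  variable
    A : Set
    a b x y : A
    s t X : Subset A

pair-comm : pair a b ≐ pair b a
pair-comm = swap , swap

pair-∋ˡ : a ∈ pair a b
pair-∋ˡ = inj₁ refl

pair-∋ʳ : b ∈ pair a b
pair-∋ʳ = inj₂ refl

≐pair-members : X ≐ pair a b → x ∈ X → y ∈ X →
                X ≐ pair x y ⊎ (x ≡ y × ∃ λ c → X ≐ pair x c)
≐pair-members X≐ab x∈X y∈X with proj₁ X≐ab x∈X | proj₁ X≐ab y∈X
... | inj₁ refl | inj₁ refl = inj₂ (refl , _ , X≐ab)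
... | inj₁ refl | inj₂ refl = inj₁ X≐ab
... | inj₂ refl | inj₁ refl = inj₁ (≐-trans X≐ab pair-comm)
... | inj₂ refl | inj₂ refl = inj₂ (refl , _ , ≐-trans X≐ab pair-comm)

pairF-∋ˡ : s ∈ pairF s t
pairF-∋ˡ = inj₁ ≐-refl

pairF-∋ʳ : t ∈ pairF s t
pairF-∋ʳ = inj₂ ≐-refl

⋃-pairF⁺ˡ : x ∈ s → x ∈ ⋃ (pairF s t)
⋃-pairF⁺ˡ x∈s = _ , pairF-∋ˡ , x∈s

⋃-pairF⁺ʳ : x ∈ t → x ∈ ⋃ (pairF s t)
⋃-pairF⁺ʳ x∈t = _ , pairF-∋ʳ , x∈t

⋃-pairF⁻ : x ∈ ⋃ (pairF s t) → x ∈ s ⊎ x ∈ t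
⋃-pairF⁻ (_ , inj₁ r≐s , x∈r) = inj₁ (proj₁ r≐s x∈r)
⋃-pairF⁻ (_ , inj₂ r≐t , x∈r) = inj₂ (proj₁ r≐t x∈r)

⊗-pair-∩ : a ∈ s → a ∈ t → b ∈ s ⊎ b ∈ t → X ≐ pair a b → X ∈ s ⊗ t
⊗-pair-∩ a∈s a∈t (inj₁ b∈s) X≐ab = _ , _ , b∈s , a∈t , ≐-trans X≐ab pair-comm
⊗-pair-∩ a∈s a∈t (inj₂ b∈t) X≐ab = _ , _ , a∈s , b∈t , X≐ab

⊗⊆Pow*₁₂ : s ⊗ t ⊆ Pow*₁₂ (pairF s t)
⊗⊆Pow*₁₂ {s = s} {t = t} {x = X} (u , v , u∈s , v∈t , X≐uv) =
  X⊆⋃ , (u , v , X≐uv) , meets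
  where
  X⊆⋃ : X ⊆ ⋃ (pairF s t)
  X⊆⋃ x∈X with proj₁ X≐uv x∈X
  ... | inj₁ refl = ⋃-pairF⁺ˡ u∈s
  ... | inj₂ refl = ⋃-pairF⁺ʳ v∈t

  meets : ∀ {r} → r ∈ pairF s t → ∃ λ x → x ∈ X × x ∈ r
  meets (inj₁ r≐s) = u , proj₂ X≐uv pair-∋ˡ , proj₂ r≐s u∈s
  meets (inj₂ r≐t) = v , proj₂ X≐uv pair-∋ʳ , proj₂ r≐t v∈t

Pow*₁₂⊆⊗ : Pow*₁₂ (pairF s t) ⊆ s ⊗ t
Pow*₁₂⊆⊗ (X⊆⋃ , (_ , _ , X≐ab) , meets)
  with meets pairF-∋ˡ | meets pairF-∋ʳ
... | x , x∈X , x∈s | y , y∈X , y∈t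
  with ≐pair-members X≐ab x∈X y∈X
... | inj₁ X≐xy = _ , _ , x∈s , y∈t , X≐xy
... | inj₂ (refl , c , X≐xc) =
  ⊗-pair-∩ x∈s y∈t (⋃-pairF⁻ (X⊆⋃ (proj₂ X≐xc pair-∋ʳ))) X≐xc

lemma10 : {A : Set} (s t : Subset A) → Pow*₁₂ (pairF s t) ≐F (s ⊗ t)
lemma10 s t X = Pow*₁₂⊆⊗ , ⊗⊆Pow*₁₂
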